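{- For every integer $n\geq 0$, $\overline{pl}(2n+1)\equiv \overline{p}(2n+1)\pmod 4$.
   Context: A plane overpartition of $n$ is a plane partition of $n$ (an array $(\pi_{ij})_{i,j\geq1}$ of nonnegative integers, weakly decreasing along rows and down columns, with $\sum\pi_{ij}=n$) in which entries may be overlined subject to: in each row, the last occurrence of an integer may be overlined or not and all other occurrences of that integer in the row are not overlined; in each column, the first occurrence of an integer may be overlined or not and all other occurrences of that integer in the column are overlined. $\overline{pl}(n)$ denotes the number of plane overpartitions of $n$; its generating function is $\prod_{n\geq1}\frac{(1+q^n)^n}{(1-q^n)^n}$. An overpartition of $n$ is a partition of $n$ in which the first occurrence of each part may be overlined; $\overline{p}(n)$ is the number of overpartitions of $n$, with generating function $\prod_{n\geq1}\frac{1+q^n}{1-q^n}$. -}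

module Defs where

open import Data.Nat using (ℕ; _≤_; _+_)
open import Data.Bool using (Bool; true; false)
open import Data.Product using (_×_; proj₁; proj₂)
open import Data.Unit using (⊤)
open import Data.Empty using (⊥)
open import Data.List using (List; []; _∷_; map)
open import Data.Nat.ListAction using (sum)
open import Data.List.Membership.Propositional using (_∈_)
open import Data.List.Relation.Unary.All using (All)
open import Data.List.Relation.Unary.Unique.Propositional using (Unique)
open import Relation.Binary.PropositionalEquality using (_≡_)

-- An entry of a (plane) overpartition: its value and whether it is overlined.
Entry : Set
Entry = ℕ × Bool

Row : Set
Row = List Entry

-- A plane array, given by its nonempty rows of nonzero entries, top row first,
-- each row listed left to right. (Zero entries are not stored; they are never
-- overlined.)
Plane : Set
Plane = List Row

IsOverList : Row → Set
IsOverList [] = ⊤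
IsOverList (x ∷ []) = 1 ≤ proj₁ x
IsOverList (x ∷ y ∷ r) =
  1 ≤ proj₁ x × proj₁ y ≤ proj₁ x × (proj₁ x ≡ proj₁ y → proj₂ y ≡ false)
  × IsOverList (y ∷ r)

weight : Row → ℕ
weight r = sum (map proj₁ r)

IsOverpartition : ℕ → Row → Set
IsOverpartition n r = IsOverList r × weight r ≡ n

RowOK : Row → Set
RowOK [] = ⊤
RowOK (x ∷ []) = 1 ≤ proj₁ x
RowOK (x ∷ y ∷ r) =
  1 ≤ proj₁ x × proj₁ y ≤ proj₁ x × (proj₁ x ≡ proj₁ y → proj₂ x ≡ false)
  × RowOK (y ∷ r)

Below : Row → Row → Set
Below _ [] = ⊤
Below [] (_ ∷ _) = ⊥
Below (x ∷ r) (y ∷ s) =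
  proj₁ y ≤ proj₁ x × (proj₁ x ≡ proj₁ y → proj₂ y ≡ true) × Below r s

NonEmpty : Row → Set
NonEmpty [] = ⊥
NonEmpty (_ ∷ _) = ⊤

RowsOK : Plane → Set
RowsOK [] = ⊤
RowsOK (r ∷ []) = NonEmpty r × RowOK r
RowsOK (r ∷ s ∷ rs) = NonEmpty r × RowOK r × Below r s × RowsOK (s ∷ rs)

planeWeight : Plane → ℕ
planeWeight π = sum (map weight π)

IsPlaneOverpartition : ℕ → Plane → Set
IsPlaneOverpartition n π = RowsOK π × planeWeight π ≡ n

-- xs is a duplicate-free list of exactly the objects satisfying P;
-- so length xs is the number of such objects.

Enumerates : {A : Set} → (A → Set) → List A → Set
Enumerates P xs = Unique xs × All P xs × (∀ x → P x → x ∈ xs)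

{-# OPTIONS --safe #-}
-- An entry of a plane overpartition that is the last of its value in its row and
-- differs from the entry above it may be overlined or not, independently of all
-- other entries; likewise the first occurrence of each part of an overpartition.
-- Toggling the first such free mark pairs off all objects of a given weight, and
-- toggling the second one pairs off those whose first mark is unset, except the
-- objects with a single free entry. So both counts are congruent modulo 4 to twice
-- the number of objects with a single, unmarked free entry: the hooks (a row of
-- a + 1 copies of d above a column of l overlined copies of d), respectively the
-- constant partitions d + ... + d. Swapping arm and leg pairs off the hooks with
-- a ≠ l, and when the weight is odd the hooks with a = l correspond to the
-- constant partitions with 2a + 1 parts.
module Submission where

open import Data.Bool using (Bool; true; false; not; _∧_)
open import Data.Bool.Properties using (not-¬; not-involutive; ∧-zeroʳ) renaming (_≟_ to _≟ᵇ_)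
open import Data.Empty using (⊥)
open import Data.List
  using (List; []; _∷_; length; map; filter; deduplicate; concatMap; drop; replicate; upTo; cartesianProduct)
open import Data.List.Properties using (length-map; map-∘; ∷-injective; length-replicate)
import Data.List.Properties as List
open import Data.List.Membership.Propositional using (_∈_)
open import Data.List.Membership.Propositional.Properties
  using ( ∈-map⁺; ∈-map⁻; ∈-filter⁺; ∈-filter⁻; ∈-deduplicate⁺; ∈-deduplicate⁻; ∈-concatMap⁺
        ; ∈-upTo⁺; ∈-cartesianProduct⁺)
open import Data.List.Membership.Propositional.Properties.WithK using (unique∧set⇒bag)
open import Data.List.Relation.Unary.Any as Any using (here; there)
open import Data.List.Relation.Unary.All as All using (All; []; _∷_)
import Data.List.Relation.Unary.All.Properties as All
open import Data.List.Relation.Unary.AllPairs using (_∷_; [])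
open import Data.List.Relation.Unary.Unique.Propositional using (Unique)
import Data.List.Relation.Unary.Unique.Propositional.Properties as Unique
import Data.List.Relation.Unary.Unique.DecPropositional.Properties as UniqueDec
open import Data.List.Relation.Binary.Pointwise using (Pointwise; []; _∷_)
open import Data.List.Relation.Binary.BagAndSetEquality using (∼bag⇒↭)
open import Data.List.Relation.Binary.Permutation.Propositional.Properties using (↭-length)
open import Data.Nat using (ℕ; zero; suc; _+_; _*_; _%_; _∸_; _≤_; _<_; _≟_; _≤?_; _<?_; z≤n; s≤s; ⌊_/2⌋)
open import Data.Nat.DivMod using ([m+kn]%n≡m%n)
open import Data.Nat.ListAction using (sum)
open import Data.Nat.Properties
open import Data.Product using (Σ; ∃; ∃₂; _×_; _,_; proj₁; proj₂)
import Data.Product.Properties as Product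
open import Data.Sum using (_⊎_; inj₁; inj₂)
open import Data.Unit using (⊤; tt)
open import Function using (_∘_)
open import Function.Bundles using (mk⇔)
open import Level using (0ℓ)
open import Relation.Binary.Definitions using (DecidableEquality)
open import Relation.Binary.PropositionalEquality
open import Relation.Nullary using (¬_; Dec; yes; no; contradiction)
open import Relation.Nullary.Decidable using (⌊_⌋; _×-dec_; _→-dec_)
open import Relation.Unary using (Pred; Decidable)
open import Relation.Unary.Properties using (∁?)

open import Defs

module _ {A B : Set} (f : A → B) where

  map⁺-injectiveOn : ∀ {xs} → Unique xs →
    (∀ {x y} → x ∈ xs → y ∈ xs → f x ≡ f y → x ≡ y) → Unique (map f xs)
  map⁺-injectiveOn {[]} [] _ = []
  map⁺-injectiveOn {x ∷ xs} (x∉ ∷ !xs) inj =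
    All.map⁺ (All.tabulate λ y∈ fx≡fy → All.lookup x∉ y∈ (inj (here refl) (there y∈) fx≡fy))
    ∷ map⁺-injectiveOn !xs λ p q → inj (there p) (there q)

  length-≡-by-inverses : ∀ {xs ys} (g : B → A) → Unique xs → Unique ys →
    (∀ {x} → x ∈ xs → f x ∈ ys) → (∀ {y} → y ∈ ys → g y ∈ xs) →
    (∀ {x} → x ∈ xs → g (f x) ≡ x) → (∀ {y} → y ∈ ys → f (g y) ≡ y) →
    length xs ≡ length ys
  length-≡-by-inverses {xs} {ys} g !xs !ys f∈ g∈ gf fg =
    trans (sym (length-map f xs)) (↭-length (∼bag⇒↭ (unique∧set⇒bag !fxs !ys (mk⇔ to from))))
    where
    !fxs : Unique (map f xs)
    !fxs = map⁺-injectiveOn !xs λ p q fx≡fy → trans (sym (gf p)) (trans (cong g fx≡fy) (gf q))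
    to : ∀ {z} → z ∈ map f xs → z ∈ ys
    to z∈ with ∈-map⁻ f z∈
    ... | x , x∈ , refl = f∈ x∈
    from : ∀ {z} → z ∈ ys → z ∈ map f xs
    from z∈ = subst (_∈ map f xs) (fg z∈) (∈-map⁺ f (g∈ z∈))

length-≡-by-members : {A : Set} {xs ys : List A} → Unique xs → Unique ys →
  (∀ {x} → x ∈ xs → x ∈ ys) → (∀ {x} → x ∈ ys → x ∈ xs) → length xs ≡ length ys
length-≡-by-members !xs !ys to from =
  length-≡-by-inverses (λ x → x) (λ x → x) !xs !ys to from (λ _ → refl) (λ _ → refl)

module _ {A : Set} {P : Pred A 0ℓ} (P? : Decidable P) where

  length-filter+filter-∁ : ∀ xs → length (filter P? xs) + length (filter (∁? P?) xs) ≡ length xs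
  length-filter+filter-∁ [] = refl
  length-filter+filter-∁ (x ∷ xs) with P? x
  ... | yes _ = cong suc (length-filter+filter-∁ xs)
  ... | no _ = trans (+-suc _ _) (cong suc (length-filter+filter-∁ xs))

module Involution {A : Set} (_≟ᴬ_ : DecidableEquality A) (f : A → A) where

  Fixed? : Decidable (λ x → f x ≡ x)
  Fixed? x = f x ≟ᴬ x

  Moved? : Decidable (λ x → ¬ f x ≡ x)
  Moved? = ∁? Fixed?

  record InvolutiveOn (xs : List A) : Set where
    field
      f∈ : ∀ {x} → x ∈ xs → f x ∈ xs
      ff : ∀ {x} → x ∈ xs → f (f x) ≡ x

  open InvolutiveOn

  length≡2*swapped : ∀ {xs} → Unique xs → InvolutiveOn xs →
    ∀ {Q : Pred A 0ℓ} (Q? : Decidable Q) →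
    (∀ {x} → x ∈ xs → Q x → ¬ Q (f x)) → (∀ {x} → x ∈ xs → ¬ Q x → Q (f x)) →
    length xs ≡ 2 * length (filter Q? xs)
  length≡2*swapped {xs} !xs inv Q? Q⇒¬Qf ¬Q⇒Qf = begin
    length xs                                            ≡⟨ length-filter+filter-∁ Q? xs ⟨
    length (filter Q? xs) + length (filter (∁? Q?) xs)   ≡⟨ cong (length (filter Q? xs) +_) halves ⟨
    length (filter Q? xs) + length (filter Q? xs)        ≡⟨ cong (length (filter Q? xs) +_) (+-identityʳ _) ⟨
    2 * length (filter Q? xs)                            ∎
    where
    open ≡-Reasoning
    into : ∀ {R : Pred A 0ℓ} (R? : Decidable R) {S : Pred A 0ℓ} (S? : Decidable S) →
      (∀ {x} → x ∈ xs → R x → S (f x)) → ∀ {x} → x ∈ filter R? xs → f x ∈ filter S? xs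
    into R? S? R⇒Sf x∈ with x∈xs , Rx ← ∈-filter⁻ R? x∈ =
      ∈-filter⁺ S? (f∈ inv x∈xs) (R⇒Sf x∈xs Rx)
    back : ∀ {R : Pred A 0ℓ} (R? : Decidable R) {x} → x ∈ filter R? xs → f (f x) ≡ x
    back R? x∈ = ff inv (proj₁ (∈-filter⁻ R? x∈))
    halves : length (filter Q? xs) ≡ length (filter (∁? Q?) xs)
    halves = length-≡-by-inverses f f (Unique.filter⁺ Q? !xs) (Unique.filter⁺ (∁? Q?) !xs)
      (into Q? (∁? Q?) Q⇒¬Qf) (into (∁? Q?) Q? ¬Q⇒Qf) (back Q?) (back (∁? Q?))

  length≡fixed+2*swapped : ∀ {xs} → Unique xs → InvolutiveOn xs →
    ∀ {Q : Pred A 0ℓ} (Q? : Decidable Q) →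
    (∀ {x} → x ∈ xs → ¬ f x ≡ x → Q x → ¬ Q (f x)) →
    (∀ {x} → x ∈ xs → ¬ f x ≡ x → ¬ Q x → Q (f x)) →
    length xs ≡ length (filter Fixed? xs) + 2 * length (filter Q? (filter Moved? xs))
  length≡fixed+2*swapped {xs} !xs inv Q? Q⇒¬Qf ¬Q⇒Qf = begin
    length xs                                                 ≡⟨ length-filter+filter-∁ Fixed? xs ⟨
    length (filter Fixed? xs) + length (filter Moved? xs)     ≡⟨ cong (length (filter Fixed? xs) +_) moved ⟩
    length (filter Fixed? xs) + 2 * length (filter Q? (filter Moved? xs)) ∎
    where
    open ≡-Reasoning
    inMoved : ∀ {x} → x ∈ filter Moved? xs → x ∈ xs × ¬ f x ≡ x
    inMoved = ∈-filter⁻ Moved?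
    invMoved : InvolutiveOn (filter Moved? xs)
    invMoved .f∈ x∈ with x∈xs , fx≢x ← inMoved x∈ =
      ∈-filter⁺ Moved? (f∈ inv x∈xs) λ ffx≡fx → fx≢x (trans (sym ffx≡fx) (ff inv x∈xs))
    invMoved .ff x∈ = ff inv (proj₁ (inMoved x∈))
    moved : length (filter Moved? xs) ≡ 2 * length (filter Q? (filter Moved? xs))
    moved = length≡2*swapped (Unique.filter⁺ Moved? !xs) invMoved Q?
      (λ x∈ → let (x∈xs , fx≢x) = inMoved x∈ in Q⇒¬Qf x∈xs fx≢x)
      (λ x∈ → let (x∈xs , fx≢x) = inMoved x∈ in ¬Q⇒Qf x∈xs fx≢x)

-- Independently togglable marks

record FreeMarks (A : Set) : Set where
  field
    #free  : A → ℕ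
    mark   : ℕ → A → Bool
    toggle : ℕ → A → A
    toggle-involutive : ∀ k x → toggle k (toggle k x) ≡ x
    toggle-beyond     : ∀ {k} x → #free x ≤ k → toggle k x ≡ x
    mark-toggle       : ∀ {k} x → k < #free x → mark k (toggle k x) ≡ not (mark k x)
    mark-toggle-≢     : ∀ {j k} x → ¬ j ≡ k → mark j (toggle k x) ≡ mark j x

  OneFreeUnmarked : A → Set
  OneFreeUnmarked x = #free x ≡ 1 × mark 0 x ≡ false

  oneFreeUnmarked? : Decidable OneFreeUnmarked
  oneFreeUnmarked? x = (#free x ≟ 1) ×-dec (mark 0 x ≟ᵇ false)

  toggle-moves : ∀ {k} x → k < #free x → ¬ toggle k x ≡ x
  toggle-moves {k} x k<free tx≡x = not-¬ refl (trans (sym (cong (mark k) tx≡x)) (mark-toggle x k<free))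

2*[m+2*n]%4 : ∀ m n → (2 * (m + 2 * n)) % 4 ≡ (2 * m) % 4
2*[m+2*n]%4 m n = trans (cong (_% 4) (lemma m n)) ([m+kn]%n≡m%n (2 * m) n 4)
  where
  lemma : ∀ m n → 2 * (m + 2 * n) ≡ 2 * m + n * 4
  lemma m n = begin
    2 * (m + 2 * n)     ≡⟨ *-distribˡ-+ 2 m (2 * n) ⟩
    2 * m + 2 * (2 * n) ≡⟨ cong (2 * m +_) (trans (sym (*-assoc 2 2 n)) (*-comm 4 n)) ⟩
    2 * m + n * 4       ∎
    where
    open ≡-Reasoning

private
  ≡not⇒swaps-false : ∀ {b c} → c ≡ not b → (b ≡ false → ¬ c ≡ false) × (¬ b ≡ false → c ≡ false)
  ≡not⇒swaps-false {false} refl = (λ _ ()) , λ b≢false → contradiction refl b≢false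
  ≡not⇒swaps-false {true}  refl = (λ ()) , λ _ → refl

module _ {A : Set} (_≟ᴬ_ : DecidableEquality A) (M : FreeMarks A) where
  open FreeMarks M

  private
    module σ = Involution _≟ᴬ_ (toggle 0)
    module τ = Involution _≟ᴬ_ (toggle 1)

    unmarked? : (k : ℕ) → Decidable (λ x → mark k x ≡ false)
    unmarked? k x = mark k x ≟ᵇ false

  module _ {P : Pred A 0ℓ} {xs} (enum : Enumerates P xs)
           (P-toggle : ∀ k {x} → P x → P (toggle k x)) (free≥1 : ∀ {x} → P x → 1 ≤ #free x) where

    private
      !xs : Unique xs
      !xs = proj₁ enum

      P∈ : ∀ {x} → x ∈ xs → P x
      P∈ = All.lookup (proj₁ (proj₂ enum))

      toggle∈ : ∀ k {x} → x ∈ xs → toggle k x ∈ xs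
      toggle∈ k x∈ = proj₂ (proj₂ enum) _ (P-toggle k (P∈ x∈))

      xs₀ = filter (unmarked? 0) xs

      in₀ : ∀ {x} → x ∈ xs₀ → x ∈ xs × mark 0 x ≡ false
      in₀ = ∈-filter⁻ (unmarked? 0)

    length≡2*unmarked₀ : length xs ≡ 2 * length xs₀
    length≡2*unmarked₀ = σ.length≡2*swapped !xs
      record { f∈ = toggle∈ 0 ; ff = λ {x} _ → toggle-involutive 0 x }
      (unmarked? 0)
      (λ {x} x∈ → proj₁ (≡not⇒swaps-false (mark-toggle x (free≥1 (P∈ x∈)))))
      (λ {x} x∈ → proj₂ (≡not⇒swaps-false (mark-toggle x (free≥1 (P∈ x∈)))))

    unmarked₀≡oneFreeUnmarked+2* : ∃ λ m → length xs₀ ≡ length (filter oneFreeUnmarked? xs) + 2 * m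
    unmarked₀≡oneFreeUnmarked+2* = m₁ , trans τ-pairs (cong (_+ 2 * m₁) fixed≡)
      where
      m₁ = length (filter (unmarked? 1) (filter τ.Moved? xs₀))
      !xs₀ : Unique xs₀
      !xs₀ = Unique.filter⁺ (unmarked? 0) !xs
      τ-on-xs₀ : τ.InvolutiveOn xs₀
      τ-on-xs₀ = record
        { f∈ = λ {x} x∈ → let (x∈xs , m₀) = in₀ x∈ in
            ∈-filter⁺ (unmarked? 0) (toggle∈ 1 x∈xs) (trans (mark-toggle-≢ x λ ()) m₀)
        ; ff = λ {x} _ → toggle-involutive 1 x }
      moved⇒1<free : ∀ {x} → ¬ toggle 1 x ≡ x → 1 < #free x
      moved⇒1<free {x} moved = ≰⇒> λ free≤1 → moved (toggle-beyond x free≤1)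
      τ-pairs : length xs₀ ≡ length (filter τ.Fixed? xs₀) + 2 * m₁
      τ-pairs = τ.length≡fixed+2*swapped !xs₀ τ-on-xs₀ (unmarked? 1)
        (λ {x} _ moved → proj₁ (≡not⇒swaps-false (mark-toggle x (moved⇒1<free moved))))
        (λ {x} _ moved → proj₂ (≡not⇒swaps-false (mark-toggle x (moved⇒1<free moved))))
      to : ∀ {x} → x ∈ filter τ.Fixed? xs₀ → x ∈ filter oneFreeUnmarked? xs
      to {x} x∈ with x∈xs₀ , fixed ← ∈-filter⁻ τ.Fixed? {xs = xs₀} x∈
        with x∈xs , m₀ ← in₀ x∈xs₀ =
        ∈-filter⁺ oneFreeUnmarked? x∈xs
          (≤-antisym (≮⇒≥ λ 1<free → toggle-moves x 1<free fixed) (free≥1 (P∈ x∈xs)) , m₀)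
      from : ∀ {x} → x ∈ filter oneFreeUnmarked? xs → x ∈ filter τ.Fixed? xs₀
      from {x} x∈ with x∈xs , free≡1 , m₀ ← ∈-filter⁻ oneFreeUnmarked? {xs = xs} x∈ =
        ∈-filter⁺ τ.Fixed? (∈-filter⁺ (unmarked? 0) x∈xs m₀) (toggle-beyond x (≤-reflexive free≡1))
      fixed≡ : length (filter τ.Fixed? xs₀) ≡ length (filter oneFreeUnmarked? xs)
      fixed≡ = length-≡-by-members {xs = filter τ.Fixed? xs₀} (Unique.filter⁺ τ.Fixed? !xs₀)
        (Unique.filter⁺ oneFreeUnmarked? !xs) to from

    length%4≡2*oneFreeUnmarked%4 : length xs % 4 ≡ (2 * length (filter oneFreeUnmarked? xs)) % 4
    length%4≡2*oneFreeUnmarked%4 with m , eq ← unmarked₀≡oneFreeUnmarked+2* = begin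
      length xs % 4                                            ≡⟨ cong (_% 4) length≡2*unmarked₀ ⟩
      (2 * length xs₀) % 4                                     ≡⟨ cong (λ n → (2 * n) % 4) eq ⟩
      (2 * (length (filter oneFreeUnmarked? xs) + 2 * m)) % 4  ≡⟨ 2*[m+2*n]%4 (length (filter oneFreeUnmarked? xs)) m ⟩
      (2 * length (filter oneFreeUnmarked? xs)) % 4            ∎
      where
      open ≡-Reasoning

module _ {A : Set} where

  listsUpTo : ℕ → List A → List (List A)
  listsUpTo zero    as = [] ∷ []
  listsUpTo (suc n) as = [] ∷ concatMap (λ a → map (a ∷_) (listsUpTo n as)) as

  ∈-listsUpTo : ∀ {n as} l → length l ≤ n → All (_∈ as) l → l ∈ listsUpTo n as
  ∈-listsUpTo {zero}  []      _         _          = here refl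
  ∈-listsUpTo {suc n} []      _         _          = here refl
  ∈-listsUpTo {suc n} (a ∷ l) (s≤s l≤n) (a∈ ∷ l∈) =
    there (∈-concatMap⁺ _ (Any.map (λ { refl → ∈-map⁺ (a ∷_) (∈-listsUpTo l l≤n l∈) }) a∈))

  length≤sum : (w : A → ℕ) (l : List A) → All (λ a → 1 ≤ w a) l → length l ≤ sum (map w l)
  length≤sum w []      []           = z≤n
  length≤sum w (a ∷ l) (1≤wa ∷ 1≤w) = +-mono-≤ 1≤wa (length≤sum w l 1≤w)

  ∈⇒≤sum : (w : A → ℕ) {a : A} {l : List A} → a ∈ l → w a ≤ sum (map w l)
  ∈⇒≤sum w {l = b ∷ l} (here refl) = m≤m+n (w b) _
  ∈⇒≤sum w {l = b ∷ l} (there a∈)  = ≤-trans (∈⇒≤sum w a∈) (m≤n+m _ (w b))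

  enumerate : DecidableEquality A → {P : Pred A 0ℓ} → Decidable P → (cs : List A) →
    (∀ {x} → P x → x ∈ cs) → Σ (List A) (Enumerates P)
  enumerate _≟_ P? cs complete =
    deduplicate _≟_ (filter P? cs) ,
    UniqueDec.deduplicate-! _≟_ (filter P? cs) ,
    All.tabulate (λ x∈ → proj₂ (∈-filter⁻ P? {xs = cs} (∈-deduplicate⁻ _≟_ (filter P? cs) x∈))) ,
    λ x Px → ∈-deduplicate⁺ _≟_ (∈-filter⁺ P? (complete Px) Px)

overline : Entry → Entry
overline (v , b) = v , not b

values : Row → List ℕ
values = map proj₁

#true : List Bool → ℕ
#true []           = 0
#true (true ∷ fl)  = suc (#true fl)
#true (false ∷ fl) = #true fl

toggleAt : ℕ → List Bool → Row → Row
toggleAt k       []           r       = r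
toggleAt k       (_ ∷ _)      []      = []
toggleAt k       (false ∷ fl) (x ∷ r) = x ∷ toggleAt k fl r
toggleAt zero    (true ∷ fl)  (x ∷ r) = overline x ∷ r
toggleAt (suc k) (true ∷ fl)  (x ∷ r) = x ∷ toggleAt k fl r

markAt : ℕ → List Bool → Row → Bool
markAt k       []           r       = false
markAt k       (_ ∷ _)      []      = false
markAt k       (false ∷ fl) (x ∷ r) = markAt k fl r
markAt zero    (true ∷ fl)  (x ∷ r) = proj₂ x
markAt (suc k) (true ∷ fl)  (x ∷ r) = markAt k fl r

AgreeOff : List Bool → Row → Row → Set
AgreeOff []       []      []      = ⊤
AgreeOff (f ∷ fl) (x ∷ r) (y ∷ s) =
  proj₁ x ≡ proj₁ y × (f ≡ false → proj₂ x ≡ proj₂ y) × AgreeOff fl r s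
AgreeOff _        _       _       = ⊥

values-toggleAt : ∀ k fl r → values (toggleAt k fl r) ≡ values r
values-toggleAt k       []           r       = refl
values-toggleAt k       (_ ∷ _)      []      = refl
values-toggleAt k       (false ∷ fl) (x ∷ r) = cong (proj₁ x ∷_) (values-toggleAt k fl r)
values-toggleAt zero    (true ∷ fl)  (x ∷ r) = refl
values-toggleAt (suc k) (true ∷ fl)  (x ∷ r) = cong (proj₁ x ∷_) (values-toggleAt k fl r)

toggleAt-involutive : ∀ k fl r → toggleAt k fl (toggleAt k fl r) ≡ r
toggleAt-involutive k       []           r       = refl
toggleAt-involutive k       (_ ∷ _)      []      = refl
toggleAt-involutive k       (false ∷ fl) (x ∷ r) = cong (x ∷_) (toggleAt-involutive k fl r)
toggleAt-involutive zero    (true ∷ fl)  ((v , b) ∷ r) = cong (λ c → (v , c) ∷ r) (not-involutive b)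
toggleAt-involutive (suc k) (true ∷ fl)  (x ∷ r) = cong (x ∷_) (toggleAt-involutive k fl r)

toggleAt-beyond : ∀ {k} fl r → #true fl ≤ k → toggleAt k fl r ≡ r
toggleAt-beyond         []           r       _         = refl
toggleAt-beyond         (_ ∷ _)      []      _         = refl
toggleAt-beyond         (false ∷ fl) (x ∷ r) fl≤k      = cong (x ∷_) (toggleAt-beyond fl r fl≤k)
toggleAt-beyond {suc k} (true ∷ fl)  (x ∷ r) (s≤s fl≤k) = cong (x ∷_) (toggleAt-beyond fl r fl≤k)

markAt-toggleAt : ∀ {k} fl r → k < #true fl → length fl ≡ length r →
  markAt k fl (toggleAt k fl r) ≡ not (markAt k fl r)
markAt-toggleAt         (false ∷ fl) (x ∷ r) k<fl      eq = markAt-toggleAt fl r k<fl (suc-injective eq)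
markAt-toggleAt {zero}  (true ∷ fl)  (x ∷ r) _         _  = refl
markAt-toggleAt {suc k} (true ∷ fl)  (x ∷ r) (s≤s k<fl) eq = markAt-toggleAt fl r k<fl (suc-injective eq)

markAt-toggleAt-≢ : ∀ {j k} fl r → ¬ j ≡ k → markAt j fl (toggleAt k fl r) ≡ markAt j fl r
markAt-toggleAt-≢                 []           r       _   = refl
markAt-toggleAt-≢                 (_ ∷ _)      []      _   = refl
markAt-toggleAt-≢                 (false ∷ fl) (x ∷ r) j≢k = markAt-toggleAt-≢ fl r j≢k
markAt-toggleAt-≢ {zero}  {zero}  (true ∷ fl)  (x ∷ r) j≢k = contradiction refl j≢k
markAt-toggleAt-≢ {zero}  {suc k} (true ∷ fl)  (x ∷ r) _   = refl
markAt-toggleAt-≢ {suc j} {zero}  (true ∷ fl)  (x ∷ r) _   = refl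
markAt-toggleAt-≢ {suc j} {suc k} (true ∷ fl)  (x ∷ r) j≢k = markAt-toggleAt-≢ fl r (j≢k ∘ cong suc)

agreeOff-refl : ∀ fl r → length fl ≡ length r → AgreeOff fl r r
agreeOff-refl []       []      _  = tt
agreeOff-refl (f ∷ fl) (x ∷ r) eq = refl , (λ _ → refl) , agreeOff-refl fl r (suc-injective eq)

agreeOff-toggleAt : ∀ k fl r → length fl ≡ length r → AgreeOff fl r (toggleAt k fl r)
agreeOff-toggleAt k       []           []      _  = tt
agreeOff-toggleAt k       (false ∷ fl) (x ∷ r) eq = refl , (λ _ → refl) , agreeOff-toggleAt k fl r (suc-injective eq)
agreeOff-toggleAt zero    (true ∷ fl)  (x ∷ r) eq = refl , (λ ()) , agreeOff-refl fl r (suc-injective eq)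
agreeOff-toggleAt (suc k) (true ∷ fl)  (x ∷ r) eq = refl , (λ _ → refl) , agreeOff-toggleAt k fl r (suc-injective eq)

values-agreeOff : ∀ fl r s → AgreeOff fl r s → values r ≡ values s
values-agreeOff []       []      []      _             = refl
values-agreeOff (f ∷ fl) (x ∷ r) (y ∷ s) (x≡y , _ , a) = cong₂ _∷_ x≡y (values-agreeOff fl r s a)

#trues : List (List Bool) → ℕ
#trues []       = 0
#trues (fl ∷ F) = #true fl + #trues F

valuesᵖ : Plane → List (List ℕ)
valuesᵖ = map values

toggleAtᵖ : ℕ → List (List Bool) → Plane → Plane
toggleAtᵖ k [] π = π
toggleAtᵖ k (_ ∷ _) [] = []
toggleAtᵖ k (fl ∷ F) (r ∷ π) with k <? #true fl
... | yes _ = toggleAt k fl r ∷ π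
... | no  _ = r ∷ toggleAtᵖ (k ∸ #true fl) F π

markAtᵖ : ℕ → List (List Bool) → Plane → Bool
markAtᵖ k [] π = false
markAtᵖ k (_ ∷ _) [] = false
markAtᵖ k (fl ∷ F) (r ∷ π) with k <? #true fl
... | yes _ = markAt k fl r
... | no  _ = markAtᵖ (k ∸ #true fl) F π

AgreeOffᵖ : List (List Bool) → Plane → Plane → Set
AgreeOffᵖ []       []      []      = ⊤
AgreeOffᵖ (fl ∷ F) (r ∷ π) (s ∷ σ) = AgreeOff fl r s × AgreeOffᵖ F π σ
AgreeOffᵖ _        _       _       = ⊥

Alignedᵖ : List (List Bool) → Plane → Set
Alignedᵖ = Pointwise (λ fl r → length fl ≡ length r)

private
  k<m+n⇒k∸m<n : ∀ {k} m {n} → ¬ k < m → k < m + n → k ∸ m < n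
  k<m+n⇒k∸m<n {k} m {n} k≮m k<m+n = subst (k ∸ m <_) (m+n∸m≡n m n) (∸-monoˡ-< k<m+n (≮⇒≥ k≮m))

  m+n≤k⇒n≤k∸m : ∀ m {n k} → m + n ≤ k → n ≤ k ∸ m
  m+n≤k⇒n≤k∸m m {n} m+n≤k = subst (_≤ _ ∸ m) (m+n∸m≡n m n) (∸-monoˡ-≤ m m+n≤k)

values-toggleAtᵖ : ∀ k F π → valuesᵖ (toggleAtᵖ k F π) ≡ valuesᵖ π
values-toggleAtᵖ k [] π = refl
values-toggleAtᵖ k (_ ∷ _) [] = refl
values-toggleAtᵖ k (fl ∷ F) (r ∷ π) with k <? #true fl
... | yes _ = cong (_∷ valuesᵖ π) (values-toggleAt k fl r)
... | no  _ = cong (values r ∷_) (values-toggleAtᵖ (k ∸ #true fl) F π)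

toggleAtᵖ-involutive : ∀ k F π → toggleAtᵖ k F (toggleAtᵖ k F π) ≡ π
toggleAtᵖ-involutive k [] π = refl
toggleAtᵖ-involutive k (_ ∷ _) [] = refl
toggleAtᵖ-involutive k (fl ∷ F) (r ∷ π) with k <? #true fl in eq
... | yes _ rewrite eq = cong (_∷ π) (toggleAt-involutive k fl r)
... | no  _ rewrite eq = cong (r ∷_) (toggleAtᵖ-involutive (k ∸ #true fl) F π)

toggleAtᵖ-beyond : ∀ {k} F π → #trues F ≤ k → toggleAtᵖ k F π ≡ π
toggleAtᵖ-beyond [] π _ = refl
toggleAtᵖ-beyond (_ ∷ _) [] _ = refl
toggleAtᵖ-beyond {k} (fl ∷ F) (r ∷ π) F≤k with k <? #true fl
... | yes k<fl = contradiction (≤-trans (m≤m+n (#true fl) (#trues F)) F≤k) (<⇒≱ k<fl)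
... | no  _    = cong (r ∷_) (toggleAtᵖ-beyond F π (m+n≤k⇒n≤k∸m (#true fl) F≤k))

markAtᵖ-toggleAtᵖ : ∀ {k} F π → k < #trues F → Alignedᵖ F π →
  markAtᵖ k F (toggleAtᵖ k F π) ≡ not (markAtᵖ k F π)
markAtᵖ-toggleAtᵖ {k} (fl ∷ F) (r ∷ π) k<F (eq ∷ aligned) with k <? #true fl in e
... | yes k<fl rewrite e = markAt-toggleAt fl r k<fl eq
... | no  k≮fl rewrite e = markAtᵖ-toggleAtᵖ F π (k<m+n⇒k∸m<n (#true fl) k≮fl k<F) aligned

markAtᵖ-toggleAtᵖ-≢ : ∀ {j k} F π → ¬ j ≡ k → markAtᵖ j F (toggleAtᵖ k F π) ≡ markAtᵖ j F π
markAtᵖ-toggleAtᵖ-≢ [] π _ = refl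
markAtᵖ-toggleAtᵖ-≢ (_ ∷ _) [] _ = refl
markAtᵖ-toggleAtᵖ-≢ {j} {k} (fl ∷ F) (r ∷ π) j≢k with k <? #true fl
... | yes _ with j <? #true fl
...   | yes _ = markAt-toggleAt-≢ fl r j≢k
...   | no  _ = refl
markAtᵖ-toggleAtᵖ-≢ {j} {k} (fl ∷ F) (r ∷ π) j≢k | no k≮fl with j <? #true fl
...   | yes _   = refl
...   | no j≮fl =
  markAtᵖ-toggleAtᵖ-≢ F π λ eq → j≢k (∸-cancelʳ-≡ (≮⇒≥ j≮fl) (≮⇒≥ k≮fl) eq)

agreeOffᵖ-refl : ∀ F π → Alignedᵖ F π → AgreeOffᵖ F π π
agreeOffᵖ-refl [] [] [] = tt
agreeOffᵖ-refl (fl ∷ F) (r ∷ π) (eq ∷ aligned) = agreeOff-refl fl r eq , agreeOffᵖ-refl F π aligned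

agreeOffᵖ-toggleAtᵖ : ∀ k F π → Alignedᵖ F π → AgreeOffᵖ F π (toggleAtᵖ k F π)
agreeOffᵖ-toggleAtᵖ k [] [] [] = tt
agreeOffᵖ-toggleAtᵖ k (fl ∷ F) (r ∷ π) (eq ∷ aligned) with k <? #true fl
... | yes _ = agreeOff-toggleAt k fl r eq , agreeOffᵖ-refl F π aligned
... | no  _ = agreeOff-refl fl r eq , agreeOffᵖ-toggleAtᵖ (k ∸ #true fl) F π aligned

-- Free entries of (plane) overpartitions

_≢head_ : ℕ → List ℕ → Bool
v ≢head []      = true
v ≢head (w ∷ _) = not ⌊ v ≟ w ⌋

rowFree : List ℕ → List ℕ → List Bool
rowFree u []       = []
rowFree u (v ∷ vs) = (v ≢head vs ∧ v ≢head u) ∷ rowFree (drop 1 u) vs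

planeFree : List ℕ → List (List ℕ) → List (List Bool)
planeFree u []         = []
planeFree u (vs ∷ vss) = rowFree u vs ∷ planeFree vs vss

partFree : List ℕ → List ℕ → List Bool
partFree p []       = []
partFree p (v ∷ vs) = v ≢head p ∷ partFree (v ∷ []) vs

length-rowFree : ∀ u vs → length (rowFree u vs) ≡ length vs
length-rowFree u []       = refl
length-rowFree u (v ∷ vs) = cong suc (length-rowFree (drop 1 u) vs)

length-partFree : ∀ p vs → length (partFree p vs) ≡ length vs
length-partFree p []       = refl
length-partFree p (v ∷ vs) = cong suc (length-partFree (v ∷ []) vs)

alignedᵖ-planeFree : ∀ u π → Alignedᵖ (planeFree u (valuesᵖ π)) π
alignedᵖ-planeFree u []      = []
alignedᵖ-planeFree u (r ∷ π) =
  trans (length-rowFree u (values r)) (length-map proj₁ r) ∷ alignedᵖ-planeFree (values r) π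

nonEmpty-agreeOff : ∀ fl r s → AgreeOff fl r s → NonEmpty r → NonEmpty s
nonEmpty-agreeOff (_ ∷ _) (_ ∷ _) (_ ∷ _) _ _ = tt
nonEmpty-agreeOff (false ∷ _) (_ ∷ _) [] () _
nonEmpty-agreeOff (true ∷ _) (_ ∷ _) [] () _

≢head-≡ : ∀ {v w} ws → v ≡ w → v ≢head (w ∷ ws) ≡ false
≢head-≡ {v} {w} ws v≡w with v ≟ w
... | yes _  = refl
... | no v≢w = contradiction v≡w v≢w

≢head-≢ : ∀ {v w} ws → ¬ v ≡ w → v ≢head (w ∷ ws) ≡ true
≢head-≢ {v} {w} ws v≢w with v ≟ w
... | yes v≡w = contradiction v≡w v≢w
... | no  _   = refl

rowOK-agreeOff : ∀ u r s → RowOK r → AgreeOff (rowFree u (values r)) r s → RowOK s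
rowOK-agreeOff u []           []           _  _ = tt
rowOK-agreeOff u (x ∷ [])     (y ∷ [])     1≤x (x≡y , _) = subst (1 ≤_) x≡y 1≤x
rowOK-agreeOff u (x ∷ x₂ ∷ r) (y ∷ y₂ ∷ s)
  (1≤x , x₂≤x , x≡x₂⇒unmarked , ok) (x≡y , fixed , agree@(x₂≡y₂ , _)) =
  subst (1 ≤_) x≡y 1≤x ,
  subst₂ _≤_ x₂≡y₂ x≡y x₂≤x ,
  (λ y≡y₂ → let x≡x₂ = trans x≡y (trans y≡y₂ (sym x₂≡y₂)) in
    trans (sym (fixed (cong (_∧ (proj₁ x ≢head u)) (≢head-≡ (values r) x≡x₂))))
          (x≡x₂⇒unmarked x≡x₂)) ,
  rowOK-agreeOff (drop 1 u) (x₂ ∷ r) (y₂ ∷ s) ok agree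
rowOK-agreeOff u (_ ∷ [])     (_ ∷ _ ∷ _)  _ (_ , _ , ())
rowOK-agreeOff u (_ ∷ _ ∷ _)  (_ ∷ [])     _ (_ , _ , ())

below-agreeOff : ∀ u r s → Below u r → AgreeOff (rowFree (values u) (values r)) r s → Below u s
below-agreeOff u       []      []      _ _ = tt
below-agreeOff (a ∷ u) (x ∷ r) (y ∷ s) (x≤a , a≡x⇒marked , below) (x≡y , fixed , agree) =
  subst (_≤ proj₁ a) x≡y x≤a ,
  (λ a≡y → let a≡x = trans a≡y (sym x≡y) in
    trans (sym (fixed (trans (cong (proj₁ x ≢head values r ∧_) (≢head-≡ (values u) (sym a≡x)))
                             (∧-zeroʳ (proj₁ x ≢head values r)))))
          (a≡x⇒marked a≡x)) ,
  below-agreeOff u r s below agree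

below-values : ∀ r r′ t → values r ≡ values r′ → Below r t → Below r′ t
below-values _       _         []      _  _ = tt
below-values (x ∷ r) (x′ ∷ r′) (y ∷ t) eq (y≤x , x≡y⇒marked , below)
  with x≡x′ , eq′ ← ∷-injective eq =
  subst (proj₁ y ≤_) x≡x′ y≤x ,
  (λ x′≡y → x≡y⇒marked (trans x≡x′ x′≡y)) ,
  below-values r r′ t eq′ below

rowsOK-agreeOffᵖ : ∀ u π σ → RowsOK π → AgreeOffᵖ (planeFree u (valuesᵖ π)) π σ → RowsOK σ
rowsOK-agreeOffᵖ u []           []           _ _ = tt
rowsOK-agreeOffᵖ u (r ∷ [])     (s ∷ [])     (ne , ok) (agree , _) =
  nonEmpty-agreeOff _ r s agree ne , rowOK-agreeOff u r s ok agree
rowsOK-agreeOffᵖ u (r ∷ r₂ ∷ π) (s ∷ s₂ ∷ σ) (ne , ok , below , oks) (agree , agreeᵖ@(agree₂ , _)) =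
  nonEmpty-agreeOff _ r s agree ne ,
  rowOK-agreeOff u r s ok agree ,
  below-values r s s₂ (values-agreeOff _ r s agree) (below-agreeOff r r₂ s₂ below agree₂) ,
  rowsOK-agreeOffᵖ (values r) (r₂ ∷ π) (s₂ ∷ σ) oks agreeᵖ
rowsOK-agreeOffᵖ u (_ ∷ [])     (_ ∷ _ ∷ _)  _ (_ , ())
rowsOK-agreeOffᵖ u (_ ∷ _ ∷ _)  (_ ∷ [])     _ (_ , ())

isOverList-agreeOff : ∀ p r s → IsOverList r → AgreeOff (partFree p (values r)) r s → IsOverList s
isOverList-agreeOff p []           []           _  _ = tt
isOverList-agreeOff p (x ∷ [])     (y ∷ [])     1≤x (x≡y , _) = subst (1 ≤_) x≡y 1≤x
isOverList-agreeOff p (x ∷ x₂ ∷ r) (y ∷ y₂ ∷ s)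
  (1≤x , x₂≤x , x≡x₂⇒unmarked , ok) (x≡y , _ , agree@(x₂≡y₂ , fixed₂ , _)) =
  subst (1 ≤_) x≡y 1≤x ,
  subst₂ _≤_ x₂≡y₂ x≡y x₂≤x ,
  (λ y≡y₂ → let x≡x₂ = trans x≡y (trans y≡y₂ (sym x₂≡y₂)) in
    trans (sym (fixed₂ (≢head-≡ [] (sym x≡x₂)))) (x≡x₂⇒unmarked x≡x₂)) ,
  isOverList-agreeOff (proj₁ x ∷ []) (x₂ ∷ r) (y₂ ∷ s) ok agree
isOverList-agreeOff p (_ ∷ [])     (_ ∷ _ ∷ _)  _ (_ , _ , ())
isOverList-agreeOff p (_ ∷ _ ∷ _)  (_ ∷ [])     _ (_ , _ , ())

freeᵖ : Plane → List (List Bool)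
freeᵖ π = planeFree [] (valuesᵖ π)

freeᵖ-toggleAtᵖ : ∀ k π → freeᵖ (toggleAtᵖ k (freeᵖ π) π) ≡ freeᵖ π
freeᵖ-toggleAtᵖ k π = cong (planeFree []) (values-toggleAtᵖ k (freeᵖ π) π)

planeMarks : FreeMarks Plane
planeMarks = record
  { #free  = λ π → #trues (freeᵖ π)
  ; mark   = λ k π → markAtᵖ k (freeᵖ π) π
  ; toggle = λ k π → toggleAtᵖ k (freeᵖ π) π
  ; toggle-involutive = involutive
  ; toggle-beyond     = λ π → toggleAtᵖ-beyond (freeᵖ π) π
  ; mark-toggle       = mark-toggle
  ; mark-toggle-≢     = mark-toggle-≢
  }
  where
  involutive : ∀ k π → toggleAtᵖ k (freeᵖ (toggleAtᵖ k (freeᵖ π) π)) (toggleAtᵖ k (freeᵖ π) π) ≡ π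
  involutive k π rewrite freeᵖ-toggleAtᵖ k π = toggleAtᵖ-involutive k (freeᵖ π) π
  mark-toggle : ∀ {k} π → k < #trues (freeᵖ π) →
    markAtᵖ k (freeᵖ (toggleAtᵖ k (freeᵖ π) π)) (toggleAtᵖ k (freeᵖ π) π) ≡ not (markAtᵖ k (freeᵖ π) π)
  mark-toggle {k} π k<free rewrite freeᵖ-toggleAtᵖ k π =
    markAtᵖ-toggleAtᵖ (freeᵖ π) π k<free (alignedᵖ-planeFree [] π)
  mark-toggle-≢ : ∀ {j k} π → ¬ j ≡ k →
    markAtᵖ j (freeᵖ (toggleAtᵖ k (freeᵖ π) π)) (toggleAtᵖ k (freeᵖ π) π) ≡ markAtᵖ j (freeᵖ π) π
  mark-toggle-≢ {k = k} π j≢k rewrite freeᵖ-toggleAtᵖ k π = markAtᵖ-toggleAtᵖ-≢ (freeᵖ π) π j≢k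

planeWeight-valuesᵖ : ∀ π σ → valuesᵖ π ≡ valuesᵖ σ → planeWeight π ≡ planeWeight σ
planeWeight-valuesᵖ π σ eq = begin
  sum (map (sum ∘ values) π)   ≡⟨ cong sum (map-∘ π) ⟩
  sum (map sum (valuesᵖ π))    ≡⟨ cong (sum ∘ map sum) eq ⟩
  sum (map sum (valuesᵖ σ))    ≡⟨ cong sum (map-∘ σ) ⟨
  sum (map (sum ∘ values) σ)   ∎
  where
  open ≡-Reasoning

isPlaneOverpartition-toggle : ∀ {N} k {π} → IsPlaneOverpartition N π →
  IsPlaneOverpartition N (FreeMarks.toggle planeMarks k π)
isPlaneOverpartition-toggle k {π} (ok , weight≡N) =
  rowsOK-agreeOffᵖ [] π _ ok (agreeOffᵖ-toggleAtᵖ k (freeᵖ π) π (alignedᵖ-planeFree [] π)) ,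
  trans (planeWeight-valuesᵖ _ π (values-toggleAtᵖ k (freeᵖ π) π)) weight≡N

1≤#free-rowFree-top : ∀ v vs → 1 ≤ #true (rowFree [] (v ∷ vs))
1≤#free-rowFree-top v []       = s≤s z≤n
1≤#free-rowFree-top v (w ∷ ws) =
  ≤-trans (1≤#free-rowFree-top w ws) (#true-∷ (v ≢head (w ∷ ws) ∧ true) (rowFree [] (w ∷ ws)))
  where
  #true-∷ : ∀ b fl → #true fl ≤ #true (b ∷ fl)
  #true-∷ true  fl = n≤1+n _
  #true-∷ false fl = ≤-refl

1≤#freeᵖ : ∀ {N} → 1 ≤ N → ∀ {π} → IsPlaneOverpartition N π → 1 ≤ FreeMarks.#free planeMarks π
1≤#freeᵖ 1≤N {[]}                 (_ , refl) = contradiction 1≤N λ ()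
1≤#freeᵖ _   {((v , _) ∷ r) ∷ π}  _          = ≤-trans (1≤#free-rowFree-top v (values r)) (m≤m+n _ _)
1≤#freeᵖ _   {[] ∷ []}            ((() , _) , _)
1≤#freeᵖ _   {[] ∷ _ ∷ _}         ((() , _) , _)

freeᵒ : Row → List Bool
freeᵒ r = partFree [] (values r)

freeᵒ-toggleAt : ∀ k r → freeᵒ (toggleAt k (freeᵒ r) r) ≡ freeᵒ r
freeᵒ-toggleAt k r = cong (partFree []) (values-toggleAt k (freeᵒ r) r)

aligned-freeᵒ : ∀ r → length (freeᵒ r) ≡ length r
aligned-freeᵒ r = trans (length-partFree [] (values r)) (length-map proj₁ r)

partMarks : FreeMarks Row
partMarks = record
  { #free  = λ r → #true (freeᵒ r)
  ; mark   = λ k r → markAt k (freeᵒ r) r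
  ; toggle = λ k r → toggleAt k (freeᵒ r) r
  ; toggle-involutive = involutive
  ; toggle-beyond     = λ r → toggleAt-beyond (freeᵒ r) r
  ; mark-toggle       = mark-toggle
  ; mark-toggle-≢     = mark-toggle-≢
  }
  where
  involutive : ∀ k r → toggleAt k (freeᵒ (toggleAt k (freeᵒ r) r)) (toggleAt k (freeᵒ r) r) ≡ r
  involutive k r rewrite freeᵒ-toggleAt k r = toggleAt-involutive k (freeᵒ r) r
  mark-toggle : ∀ {k} r → k < #true (freeᵒ r) →
    markAt k (freeᵒ (toggleAt k (freeᵒ r) r)) (toggleAt k (freeᵒ r) r) ≡ not (markAt k (freeᵒ r) r)
  mark-toggle {k} r k<free rewrite freeᵒ-toggleAt k r = markAt-toggleAt (freeᵒ r) r k<free (aligned-freeᵒ r)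
  mark-toggle-≢ : ∀ {j k} r → ¬ j ≡ k →
    markAt j (freeᵒ (toggleAt k (freeᵒ r) r)) (toggleAt k (freeᵒ r) r) ≡ markAt j (freeᵒ r) r
  mark-toggle-≢ {k = k} r j≢k rewrite freeᵒ-toggleAt k r = markAt-toggleAt-≢ (freeᵒ r) r j≢k

isOverpartition-toggle : ∀ {N} k {r} → IsOverpartition N r → IsOverpartition N (FreeMarks.toggle partMarks k r)
isOverpartition-toggle k {r} (ok , weight≡N) =
  isOverList-agreeOff [] r _ ok (agreeOff-toggleAt k (freeᵒ r) r (aligned-freeᵒ r)) ,
  trans (cong sum (values-toggleAt k (freeᵒ r) r)) weight≡N

1≤#freeᵒ : ∀ {N} → 1 ≤ N → ∀ {r} → IsOverpartition N r → 1 ≤ FreeMarks.#free partMarks r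
1≤#freeᵒ 1≤N {[]}    (_ , refl) = contradiction 1≤N λ ()
1≤#freeᵒ _   {_ ∷ _} _          = s≤s z≤n

#true-false : ∀ {f} fl → f ≡ false → #true (f ∷ fl) ≡ #true fl
#true-false fl refl = refl

#true-true : ∀ {f} fl → f ≡ true → #true (f ∷ fl) ≡ suc (#true fl)
#true-true fl refl = refl

#true≡0 : ∀ f fl → #true (f ∷ fl) ≡ 0 → f ≡ false × #true fl ≡ 0
#true≡0 false fl none = refl , none

markAt-false : ∀ {f} k fl x r → f ≡ false → markAt k (f ∷ fl) (x ∷ r) ≡ markAt k fl r
markAt-false k fl x r refl = refl

markAtᵖ-here : ∀ {k} fl F r π → k < #true fl → markAtᵖ k (fl ∷ F) (r ∷ π) ≡ markAt k fl r
markAtᵖ-here {k} fl F r π k<fl with k <? #true fl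
... | yes _   = refl
... | no  k≮ = contradiction k<fl k≮

markAt-unmarked : ∀ k fl d m → markAt k fl (replicate m (d , false)) ≡ false
markAt-unmarked k       []           d m       = refl
markAt-unmarked k       (_ ∷ _)      d zero    = refl
markAt-unmarked k       (false ∷ fl) d (suc m) = markAt-unmarked k fl d m
markAt-unmarked zero    (true ∷ fl)  d (suc m) = refl
markAt-unmarked (suc k) (true ∷ fl)  d (suc m) = markAt-unmarked k fl d m

≢head≡false⇒≡ : ∀ {v w} ws → v ≢head (w ∷ ws) ≡ false → v ≡ w
≢head≡false⇒≡ {v} {w} ws same with v ≟ w
... | yes v≡w = v≡w

∧≡false : ∀ b c → b ∧ c ≡ false → b ≡ false ⊎ c ≡ false
∧≡false false c _ = inj₁ refl
∧≡false true  c c≡false = inj₂ c≡false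

hook : ℕ → ℕ → ℕ → Plane
hook d a l = replicate (suc a) (d , false) ∷ replicate l ((d , true) ∷ [])

HasValue : ℕ → Entry → Set
HasValue d x = proj₁ x ≡ d

topRow-oneFreeUnmarked : ∀ x xs → RowOK (x ∷ xs) → #true (rowFree [] (values (x ∷ xs))) ≡ 1 →
  markAt 0 (rowFree [] (values (x ∷ xs))) (x ∷ xs) ≡ false →
  x ∷ xs ≡ replicate (suc (length xs)) (proj₁ x , false)
topRow-oneFreeUnmarked (v , b) []       _  _   b≡false = cong (λ c → (v , c) ∷ []) b≡false
topRow-oneFreeUnmarked (v , b) (y ∷ ys) ok one unmarked with proj₁ y ≟ v
... | yes refl = cong₂ _∷_ (cong (v ,_) b≡false) (topRow-oneFreeUnmarked y ys (proj₂ (proj₂ (proj₂ ok)))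
                   (trans (sym (#true-false _ notLast)) one)
                   (trans (sym (markAt-false 0 _ (v , b) (y ∷ ys) notLast)) unmarked))
  where
  notLast : (v ≢head values (y ∷ ys) ∧ true) ≡ false
  notLast = cong (_∧ true) (≢head-≡ (values ys) refl)
  b≡false : b ≡ false
  b≡false = proj₁ (proj₂ (proj₂ ok)) refl
... | no y≢v = contradiction (subst (1 ≤_) none (1≤#free-rowFree-top (proj₁ y) (values ys))) λ ()
  where
  last : (v ≢head values (y ∷ ys) ∧ true) ≡ true
  last = cong (_∧ true) (≢head-≢ (values ys) (y≢v ∘ sym))
  none : #true (rowFree [] (values (y ∷ ys))) ≡ 0
  none = suc-injective (trans (sym (#true-true _ last)) one)

≢head≡false-All : ∀ {v d} s → v ≢head values s ≡ false → All (HasValue d) s → v ≡ d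
≢head≡false-All (z ∷ s) same (z≡d ∷ _) = trans (≢head≡false⇒≡ (values s) same) z≡d

-- a row with no free entry under a constant row is constant: each entry equals
-- its right neighbour or the entry above
noFree-below-constant : ∀ {d} u s → All (HasValue d) u → Below u s →
  #true (rowFree (values u) (values s)) ≡ 0 → All (HasValue d) s
noFree-below-constant u       []      _          _ _ = []
noFree-below-constant (a ∷ u) (y ∷ s) (a≡d ∷ u≡d) (_ , _ , below) none
  with flag≡false , rest ← #true≡0 _ _ none with s≡d ← noFree-below-constant u s u≡d below rest
  with ∧≡false _ _ flag≡false
... | inj₁ notLast = ≢head≡false-All s notLast s≡d ∷ s≡d
... | inj₂ sameAbove = ≢head≡false-All (a ∷ u) sameAbove (a≡d ∷ u≡d) ∷ s≡d

-- equal entries in a row must be unmarked but below an equal entry marked, so a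
-- constant row under a constant row has a single entry
constant-below-constant : ∀ {d} u s → All (HasValue d) u → All (HasValue d) s → Below u s → RowOK s →
  NonEmpty s → s ≡ (d , true) ∷ []
constant-below-constant (a ∷ _) ((v , b) ∷ []) (a≡d ∷ _) (refl ∷ []) (_ , a≡y⇒marked , _) _ _ =
  cong (λ c → (v , c) ∷ []) (a≡y⇒marked a≡d)
constant-below-constant (a ∷ _) (y ∷ z ∷ _) (a≡d ∷ _) (y≡d ∷ z≡d ∷ _)
  (_ , a≡y⇒marked , _) (_ , _ , y≡z⇒unmarked , _) _ =
  contradiction (trans (sym (a≡y⇒marked (trans a≡d (sym y≡d)))) (y≡z⇒unmarked (trans y≡d (sym z≡d)))) λ ()

rowsOK-head : ∀ r π → RowsOK (r ∷ π) → NonEmpty r × RowOK r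
rowsOK-head r []      ok              = ok
rowsOK-head r (_ ∷ _) (ne , ok , _)  = ne , ok

noFree-under-constant : ∀ {d} u π → All (HasValue d) u → RowsOK (u ∷ π) →
  #trues (planeFree (values u) (valuesᵖ π)) ≡ 0 → π ≡ replicate (length π) ((d , true) ∷ [])
noFree-under-constant u []      _   _                    _    = refl
noFree-under-constant u (s ∷ π) u≡d (_ , _ , below , ok) none =
  cong₂ _∷_ s≡column (noFree-under-constant s π s≡d ok rest′)
  where
  rest  = m+n≡0⇒m≡0 _ none
  rest′ = m+n≡0⇒n≡0 (#true (rowFree (values u) (values s))) none
  s≡d   = noFree-below-constant u s u≡d below rest
  s≡column = constant-below-constant u s u≡d s≡d below (proj₂ (rowsOK-head s π ok)) (proj₁ (rowsOK-head s π ok))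

oneFreeUnmarked⇒hook : ∀ {N π} → 1 ≤ N → IsPlaneOverpartition N π →
  FreeMarks.OneFreeUnmarked planeMarks π → ∃ λ d → ∃₂ λ a l → π ≡ hook d a l
oneFreeUnmarked⇒hook {π = []} 1≤N (_ , refl) _ = contradiction 1≤N λ ()
oneFreeUnmarked⇒hook {π = [] ∷ []}    _ ((() , _) , _) _
oneFreeUnmarked⇒hook {π = [] ∷ _ ∷ _} _ ((() , _) , _) _
oneFreeUnmarked⇒hook {π = (x ∷ xs) ∷ rest} _ (ok , _) (one , unmarked) =
  proj₁ x , length xs , length rest , cong₂ _∷_ row≡ rest≡
  where
  top   = rowFree [] (values (x ∷ xs))
  below = planeFree (values (x ∷ xs)) (valuesᵖ rest)
  top≥1 : 1 ≤ #true top
  top≥1 = 1≤#free-rowFree-top (proj₁ x) (values xs)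
  top≡1 : #true top ≡ 1
  top≡1 = ≤-antisym (subst (#true top ≤_) one (m≤m+n _ _)) top≥1
  below≡0 : #trues below ≡ 0
  below≡0 = +-cancelˡ-≡ 1 _ 0 (trans (cong (_+ #trues below) (sym top≡1)) one)
  row≡ : x ∷ xs ≡ replicate (suc (length xs)) (proj₁ x , false)
  row≡ = topRow-oneFreeUnmarked x xs (proj₂ (rowsOK-head _ rest ok)) top≡1
           (trans (sym (markAtᵖ-here top below (x ∷ xs) rest top≥1)) unmarked)
  rest≡ : rest ≡ replicate (length rest) ((proj₁ x , true) ∷ [])
  rest≡ = noFree-under-constant (x ∷ xs) rest
            (subst (All (HasValue (proj₁ x))) (sym row≡) (All.replicate⁺ (suc (length xs)) refl)) ok below≡0

rowOK-unmarked : ∀ {d} a → 1 ≤ d → RowOK (replicate (suc a) (d , false))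
rowOK-unmarked zero    1≤d = 1≤d
rowOK-unmarked (suc a) 1≤d = 1≤d , ≤-refl , (λ _ → refl) , rowOK-unmarked a 1≤d

rowsOK-column : ∀ {d} b u l → 1 ≤ d → RowOK ((d , b) ∷ u) →
  RowsOK (((d , b) ∷ u) ∷ replicate l ((d , true) ∷ []))
rowsOK-column b u zero    1≤d ok = tt , ok
rowsOK-column b u (suc l) 1≤d ok = tt , ok , (≤-refl , (λ _ → refl) , tt) , rowsOK-column true [] l 1≤d 1≤d

rowsOK-hook : ∀ {d} a l → 1 ≤ d → RowsOK (hook d a l)
rowsOK-hook a l 1≤d = rowsOK-column false _ l 1≤d (rowOK-unmarked a 1≤d)

weight-replicate : ∀ {d b} k → weight (replicate k (d , b)) ≡ k * d
weight-replicate zero    = refl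
weight-replicate (suc k) = cong (_ +_) (weight-replicate k)

planeWeight-hook : ∀ d a l → planeWeight (hook d a l) ≡ (suc a + l) * d
planeWeight-hook d a l = begin
  weight (replicate (suc a) (d , false)) + planeWeight (replicate l ((d , true) ∷ []))
    ≡⟨ cong₂ _+_ (weight-replicate (suc a)) (planeWeight-column l) ⟩
  suc a * d + l * d
    ≡⟨ *-distribʳ-+ d (suc a) l ⟨
  (suc a + l) * d ∎
  where
  open ≡-Reasoning
  planeWeight-column : ∀ l → planeWeight (replicate l ((d , true) ∷ [])) ≡ l * d
  planeWeight-column zero    = refl
  planeWeight-column (suc l) = cong₂ _+_ (+-identityʳ d) (planeWeight-column l)

hook-oneFreeUnmarked : ∀ d a l → FreeMarks.OneFreeUnmarked planeMarks (hook d a l)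
hook-oneFreeUnmarked d a l =
  cong₂ _+_ (#free-top a) (#free-column (values (replicate a (d , false))) l) ,
  trans (markAtᵖ-here top _ (replicate (suc a) (d , false)) _ (subst (0 <_) (sym (#free-top a)) (s≤s z≤n)))
        (markAt-unmarked 0 top d (suc a))
  where
  top = rowFree [] (values (replicate (suc a) (d , false)))
  #free-top : ∀ a → #true (rowFree [] (values (replicate (suc a) (d , false)))) ≡ 1
  #free-top zero    = refl
  #free-top (suc a) = trans (#true-false (rowFree [] (values (replicate (suc a) (d , false))))
                               (cong (_∧ true) (≢head-≡ {d} (values (replicate a (d , false))) refl))) (#free-top a)
  #free-column : ∀ vs l → #trues (planeFree (d ∷ vs) (valuesᵖ (replicate l ((d , true) ∷ [])))) ≡ 0
  #free-column vs zero    = refl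
  #free-column vs (suc l) = cong₂ _+_ (#true-false [] (≢head-≡ {d} vs refl)) (#free-column [] l)

noFree-parts : ∀ x xs → IsOverList (x ∷ xs) → #true (partFree (proj₁ x ∷ []) (values xs)) ≡ 0 →
  xs ≡ replicate (length xs) (proj₁ x , false)
noFree-parts x       []             _  _    = refl
noFree-parts (v , b) ((w , c) ∷ ys) ok none
  with flag≡false , rest ← #true≡0 _ _ none
  with refl ← ≢head≡false⇒≡ {w} [] flag≡false =
  cong₂ _∷_ (cong (v ,_) (proj₁ (proj₂ (proj₂ ok)) refl))
            (noFree-parts (v , c) ys (proj₂ (proj₂ (proj₂ ok))) rest)

oneFreeUnmarked⇒constant : ∀ {N r} → 1 ≤ N → IsOverpartition N r →
  FreeMarks.OneFreeUnmarked partMarks r → ∃₂ λ d k → r ≡ replicate (suc k) (d , false)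
oneFreeUnmarked⇒constant {r = []} 1≤N (_ , refl) _ = contradiction 1≤N λ ()
oneFreeUnmarked⇒constant {r = (v , b) ∷ xs} _ (ok , _) (one , refl) =
  v , length xs , cong ((v , false) ∷_) (noFree-parts (v , false) xs ok (suc-injective one))

isOverList-constant : ∀ {d} k → 1 ≤ d → IsOverList (replicate (suc k) (d , false))
isOverList-constant zero    1≤d = 1≤d
isOverList-constant (suc k) 1≤d = 1≤d , ≤-refl , (λ _ → refl) , isOverList-constant k 1≤d

constant-oneFreeUnmarked : ∀ d k → FreeMarks.OneFreeUnmarked partMarks (replicate (suc k) (d , false))
constant-oneFreeUnmarked d k = cong suc (#free-rest k) , refl
  where
  #free-rest : ∀ k → #true (partFree (d ∷ []) (values (replicate k (d , false)))) ≡ 0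
  #free-rest zero    = refl
  #free-rest (suc k) =
    trans (#true-false (partFree (d ∷ []) (values (replicate k (d , false)))) (≢head-≡ {d} [] refl)) (#free-rest k)

-- Hooks and parity

corner : Plane → ℕ
corner ((x ∷ _) ∷ _) = proj₁ x
corner _             = 0

arm : Plane → ℕ
arm []      = 0
arm (r ∷ _) = length r ∸ 1

leg : Plane → ℕ
leg []      = 0
leg (_ ∷ π) = length π

swapArmLeg : Plane → Plane
swapArmLeg π = hook (corner π) (leg π) (arm π)

arm-hook : ∀ d a l → arm (hook d a l) ≡ a
arm-hook d a l = length-replicate a

leg-hook : ∀ d a l → leg (hook d a l) ≡ l
leg-hook d a l = length-replicate l

swapArmLeg-hook : ∀ d a l → swapArmLeg (hook d a l) ≡ hook d l a
swapArmLeg-hook d a l = cong₂ (hook d) (leg-hook d a l) (arm-hook d a l)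

arm-swapArmLeg : ∀ π → arm (swapArmLeg π) ≡ leg π
arm-swapArmLeg π = arm-hook (corner π) (leg π) (arm π)

leg-swapArmLeg : ∀ π → leg (swapArmLeg π) ≡ arm π
leg-swapArmLeg π = leg-hook (corner π) (leg π) (arm π)

swapArmLeg-fixes : ∀ d a l → leg (hook d a l) ≡ arm (hook d a l) → swapArmLeg (hook d a l) ≡ hook d a l
swapArmLeg-fixes d a l l≡a =
  trans (cong₂ (hook d) l≡a (sym l≡a)) (cong₂ (hook d) (arm-hook d a l) (leg-hook d a l))

even⊎odd : ∀ m → ∃ λ a → m ≡ a + a ⊎ m ≡ suc (a + a)
even⊎odd zero = 0 , inj₁ refl
even⊎odd (suc m) with even⊎odd m
... | a , inj₁ refl = a , inj₂ refl
... | a , inj₂ refl = suc a , inj₁ (cong suc (sym (+-suc a a)))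

odd-factor : ∀ m d n → m * d ≡ suc (2 * n) → ∃ λ a → m ≡ suc (a + a)
odd-factor m d n eq with even⊎odd m
... | a , inj₂ m-odd = a , m-odd
... | a , inj₁ refl = contradiction 2ad≡odd (even≢odd (a * d) n)
  where
  open ≡-Reasoning
  2ad≡odd : 2 * (a * d) ≡ suc (2 * n)
  2ad≡odd = begin
    2 * (a * d)   ≡⟨ *-assoc 2 a d ⟨
    2 * a * d     ≡⟨ cong (λ b → (a + b) * d) (+-identityʳ a) ⟩
    (a + a) * d   ≡⟨ eq ⟩
    suc (2 * n)   ∎

⌊suc[a+a]/2⌋≡a : ∀ a → ⌊ suc (a + a) /2⌋ ≡ a
⌊suc[a+a]/2⌋≡a zero    = refl
⌊suc[a+a]/2⌋≡a (suc a) = cong suc (trans (cong ⌊_/2⌋ (+-suc a a)) (⌊suc[a+a]/2⌋≡a a))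

_≟ʳ_ : DecidableEquality Row
_≟ʳ_ = List.≡-dec (Product.≡-dec _≟_ _≟ᵇ_)

_≟ᵖ_ : DecidableEquality Plane
_≟ᵖ_ = List.≡-dec _≟ʳ_

rowOK? : Decidable RowOK
rowOK? []          = yes tt
rowOK? (x ∷ [])    = 1 ≤? proj₁ x
rowOK? (x ∷ y ∷ r) =
  (1 ≤? proj₁ x) ×-dec (proj₁ y ≤? proj₁ x) ×-dec ((proj₁ x ≟ proj₁ y) →-dec (proj₂ x ≟ᵇ false)) ×-dec
  rowOK? (y ∷ r)

below? : ∀ r s → Dec (Below r s)
below? _       []      = yes tt
below? []      (_ ∷ _) = no λ ()
below? (x ∷ r) (y ∷ s) =
  (proj₁ y ≤? proj₁ x) ×-dec ((proj₁ x ≟ proj₁ y) →-dec (proj₂ y ≟ᵇ true)) ×-dec below? r s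

nonEmpty? : Decidable NonEmpty
nonEmpty? []      = no λ ()
nonEmpty? (_ ∷ _) = yes tt

rowsOK? : Decidable RowsOK
rowsOK? []           = yes tt
rowsOK? (r ∷ [])     = nonEmpty? r ×-dec rowOK? r
rowsOK? (r ∷ s ∷ π)  = nonEmpty? r ×-dec rowOK? r ×-dec below? r s ×-dec rowsOK? (s ∷ π)

isOverList? : Decidable IsOverList
isOverList? []          = yes tt
isOverList? (x ∷ [])    = 1 ≤? proj₁ x
isOverList? (x ∷ y ∷ r) =
  (1 ≤? proj₁ x) ×-dec (proj₁ y ≤? proj₁ x) ×-dec ((proj₁ x ≟ proj₁ y) →-dec (proj₂ y ≟ᵇ false)) ×-dec
  isOverList? (y ∷ r)

isPlaneOverpartition? : ∀ N → Decidable (IsPlaneOverpartition N)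
isPlaneOverpartition? N π = rowsOK? π ×-dec (planeWeight π ≟ N)

isOverpartition? : ∀ N → Decidable (IsOverpartition N)
isOverpartition? N r = isOverList? r ×-dec (weight r ≟ N)

Positive : Row → Set
Positive = All (λ x → 1 ≤ proj₁ x)

rowOK-positive : ∀ r → RowOK r → Positive r
rowOK-positive []          _  = []
rowOK-positive (x ∷ [])    ok = ok ∷ []
rowOK-positive (x ∷ y ∷ r) ok = proj₁ ok ∷ rowOK-positive (y ∷ r) (proj₂ (proj₂ (proj₂ ok)))

isOverList-positive : ∀ r → IsOverList r → Positive r
isOverList-positive []          _  = []
isOverList-positive (x ∷ [])    ok = ok ∷ []
isOverList-positive (x ∷ y ∷ r) ok = proj₁ ok ∷ isOverList-positive (y ∷ r) (proj₂ (proj₂ (proj₂ ok)))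

rowsOK-rows : ∀ π → RowsOK π → All (λ r → NonEmpty r × Positive r) π
rowsOK-rows []          _                = []
rowsOK-rows (r ∷ [])    (ne , ok)        = (ne , rowOK-positive r ok) ∷ []
rowsOK-rows (r ∷ s ∷ π) (ne , ok , _ , oks) = (ne , rowOK-positive r ok) ∷ rowsOK-rows (s ∷ π) oks

entryCandidates : ℕ → List Entry
entryCandidates N = cartesianProduct (upTo (suc N)) (false ∷ true ∷ [])

rowCandidates : ℕ → List Row
rowCandidates N = listsUpTo N (entryCandidates N)

planeCandidates : ℕ → List Plane
planeCandidates N = listsUpTo N (rowCandidates N)

∈-rowCandidates : ∀ {N} r → Positive r → weight r ≤ N → r ∈ rowCandidates N
∈-rowCandidates {N} r positive r≤N =
  ∈-listsUpTo r (≤-trans (length≤sum proj₁ r positive) r≤N) (All.tabulate entry∈)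
  where
  entry∈ : ∀ {x} → x ∈ r → x ∈ entryCandidates N
  entry∈ {v , b} x∈ =
    ∈-cartesianProduct⁺ {xs = upTo (suc N)} (∈-upTo⁺ (s≤s (≤-trans (∈⇒≤sum proj₁ x∈) r≤N))) (mark∈ b)
    where
    mark∈ : ∀ b → b ∈ false ∷ true ∷ []
    mark∈ false = here refl
    mark∈ true  = there (here refl)

∈-planeCandidates : ∀ {N} π → IsPlaneOverpartition N π → π ∈ planeCandidates N
∈-planeCandidates {N} π (ok , refl) =
  ∈-listsUpTo π (length≤sum weight π (All.map weight≥1 rows)) (All.tabulate row∈)
  where
  rows = rowsOK-rows π ok
  weight≥1 : ∀ {r} → NonEmpty r × Positive r → 1 ≤ weight r
  weight≥1 {x ∷ r} (_ , 1≤x ∷ _) = ≤-trans 1≤x (m≤m+n _ _)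
  row∈ : ∀ {r} → r ∈ π → r ∈ rowCandidates (planeWeight π)
  row∈ r∈ = ∈-rowCandidates _ (proj₂ (All.lookup rows r∈)) (∈⇒≤sum weight r∈)

planeOverpartitions : ∀ N → Σ (List Plane) (Enumerates (IsPlaneOverpartition N))
planeOverpartitions N = enumerate _≟ᵖ_ (isPlaneOverpartition? N) (planeCandidates N) (∈-planeCandidates _)

overpartitions : ∀ N → Σ (List Row) (Enumerates (IsOverpartition N))
overpartitions N = enumerate _≟ʳ_ (isOverpartition? N) (rowCandidates N)
  λ (ok , weight≡N) → ∈-rowCandidates _ (isOverList-positive _ ok) (≤-reflexive weight≡N)

firstValue : Row → ℕ
firstValue []      = 0
firstValue (x ∷ _) = proj₁ x

hookToRow : Plane → Row
hookToRow π = replicate (suc (arm π + leg π)) (corner π , false)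

rowToHook : Row → Plane
rowToHook r = hook (firstValue r) ⌊ length r /2⌋ ⌊ length r /2⌋

rowToHook-constant : ∀ d a → rowToHook (replicate (suc (a + a)) (d , false)) ≡ hook d a a
rowToHook-constant d a =
  cong (λ k → hook d k k) (trans (cong ⌊_/2⌋ (length-replicate (suc (a + a)))) (⌊suc[a+a]/2⌋≡a a))

hookToRow-hook : ∀ d a l → hookToRow (hook d a l) ≡ replicate (suc (a + l)) (d , false)
hookToRow-hook d a l = cong (λ k → replicate (suc k) (d , false)) (cong₂ _+_ (arm-hook d a l) (leg-hook d a l))

module OddWeight (n : ℕ) {xs ys}
  (enumᵖ : Enumerates (IsPlaneOverpartition (2 * n + 1)) xs)
  (enumᵒ : Enumerates (IsOverpartition (2 * n + 1)) ys) where

  open FreeMarks using (oneFreeUnmarked?)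
  module ρ = Involution _≟ᵖ_ swapArmLeg

  N = 2 * n + 1

  N≡odd : N ≡ suc (2 * n)
  N≡odd = +-comm (2 * n) 1

  1≤N : 1 ≤ N
  1≤N = subst (1 ≤_) (sym N≡odd) (s≤s z≤n)

  hooks : List Plane
  hooks = filter (oneFreeUnmarked? planeMarks) xs

  diagonal : List Plane
  diagonal = filter ρ.Fixed? hooks

  constants : List Row
  constants = filter (oneFreeUnmarked? partMarks) ys

  ∈hooks⁻ : ∀ {π} → π ∈ hooks → ∃ λ d → ∃₂ λ a l → π ≡ hook d a l × 1 ≤ d × (suc a + l) * d ≡ N
  ∈hooks⁻ {π} π∈ with π∈xs , one ← ∈-filter⁻ (oneFreeUnmarked? planeMarks) {xs = xs} π∈
    with (ok , weight≡N) ← All.lookup (proj₁ (proj₂ enumᵖ)) π∈xs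
    with d , a , l , refl ← oneFreeUnmarked⇒hook 1≤N (ok , weight≡N) one =
    d , a , l , refl , All.lookup (rowOK-positive _ (proj₂ (rowsOK-head _ _ ok))) (here refl) ,
    trans (sym (planeWeight-hook d a l)) weight≡N

  ∈hooks⁺ : ∀ {d a l} → 1 ≤ d → (suc a + l) * d ≡ N → hook d a l ∈ hooks
  ∈hooks⁺ {d} {a} {l} 1≤d weight≡N =
    ∈-filter⁺ (oneFreeUnmarked? planeMarks)
      (proj₂ (proj₂ enumᵖ) _ (rowsOK-hook a l 1≤d , trans (planeWeight-hook d a l) weight≡N))
      (hook-oneFreeUnmarked d a l)

  ∈constants⁻ : ∀ {r} → r ∈ constants →
    ∃₂ λ d a → r ≡ replicate (suc (a + a)) (d , false) × 1 ≤ d × suc (a + a) * d ≡ N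
  ∈constants⁻ {r} r∈ with r∈ys , one ← ∈-filter⁻ (oneFreeUnmarked? partMarks) {xs = ys} r∈
    with (ok , weight≡N) ← All.lookup (proj₁ (proj₂ enumᵒ)) r∈ys
    with d , k , refl ← oneFreeUnmarked⇒constant 1≤N (ok , weight≡N) one
    with a , refl ← odd-factor (suc k) d n (trans (sym (weight-replicate (suc k))) (trans weight≡N N≡odd)) =
    d , a , refl , All.lookup (isOverList-positive _ ok) (here refl) ,
    trans (sym (weight-replicate (suc (a + a)))) weight≡N

  ∈constants⁺ : ∀ {d a} → 1 ≤ d → suc (a + a) * d ≡ N → replicate (suc (a + a)) (d , false) ∈ constants
  ∈constants⁺ {d} {a} 1≤d weight≡N =
    ∈-filter⁺ (oneFreeUnmarked? partMarks)
      (proj₂ (proj₂ enumᵒ) _ (isOverList-constant (a + a) 1≤d , trans (weight-replicate (suc (a + a))) weight≡N))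
      (constant-oneFreeUnmarked d (a + a))

  !hooks : Unique hooks
  !hooks = Unique.filter⁺ (oneFreeUnmarked? planeMarks) (proj₁ enumᵖ)

  swapArmLeg-on-hooks : ρ.InvolutiveOn hooks
  swapArmLeg-on-hooks = record { f∈ = swap∈ ; ff = swap-swap }
    where
    swap∈ : ∀ {π} → π ∈ hooks → swapArmLeg π ∈ hooks
    swap∈ π∈ with d , a , l , refl , 1≤d , weight≡N ← ∈hooks⁻ π∈ =
      subst (_∈ hooks) (sym (swapArmLeg-hook d a l))
        (∈hooks⁺ 1≤d (trans (cong (λ k → suc k * d) (+-comm l a)) weight≡N))
    swap-swap : ∀ {π} → π ∈ hooks → swapArmLeg (swapArmLeg π) ≡ π
    swap-swap π∈ with d , a , l , refl , _ ← ∈hooks⁻ π∈ =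
      trans (cong swapArmLeg (swapArmLeg-hook d a l)) (swapArmLeg-hook d l a)

  armShorter? : Decidable (λ π → arm π < leg π)
  armShorter? π = suc (arm π) ≤? leg π

  swapped : ℕ
  swapped = length (filter armShorter? (filter ρ.Moved? hooks))

  hooks≡diagonal+2*swapped : length hooks ≡ length diagonal + 2 * swapped
  hooks≡diagonal+2*swapped = ρ.length≡fixed+2*swapped !hooks swapArmLeg-on-hooks armShorter?
    (λ {π} _ _ a<l l<a → <-asym a<l (subst₂ _<_ (arm-swapArmLeg π) (leg-swapArmLeg π) l<a))
    (λ {π} π∈ moved a≮l → subst₂ _<_ (sym (arm-swapArmLeg π)) (sym (leg-swapArmLeg π))
                             (≤∧≢⇒< (≮⇒≥ a≮l) (moved ∘ fixes π∈)))
    where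
    fixes : ∀ {π} → π ∈ hooks → leg π ≡ arm π → swapArmLeg π ≡ π
    fixes π∈ with d , a , l , refl , _ ← ∈hooks⁻ π∈ = swapArmLeg-fixes d a l

  ∈diagonal⁻ : ∀ {π} → π ∈ diagonal → ∃₂ λ d a → π ≡ hook d a a × 1 ≤ d × suc (a + a) * d ≡ N
  ∈diagonal⁻ π∈ with π∈hooks , fixed ← ∈-filter⁻ ρ.Fixed? {xs = hooks} π∈
    with d , a , l , refl , 1≤d , weight≡N ← ∈hooks⁻ π∈hooks
    with refl ← trans (sym (leg-hook d a l))
                  (trans (sym (arm-swapArmLeg (hook d a l))) (trans (cong arm fixed) (arm-hook d a l))) =
    d , a , refl , 1≤d , weight≡N

  ∈diagonal⁺ : ∀ {d a} → 1 ≤ d → suc (a + a) * d ≡ N → hook d a a ∈ diagonal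
  ∈diagonal⁺ {d} {a} 1≤d weight≡N = ∈-filter⁺ ρ.Fixed? (∈hooks⁺ 1≤d weight≡N) (swapArmLeg-hook d a a)

  diagonal≡constants : length diagonal ≡ length constants
  diagonal≡constants = length-≡-by-inverses hookToRow rowToHook
    (Unique.filter⁺ ρ.Fixed? !hooks) (Unique.filter⁺ (oneFreeUnmarked? partMarks) (proj₁ enumᵒ))
    to from from∘to to∘from
    where
    to : ∀ {π} → π ∈ diagonal → hookToRow π ∈ constants
    to π∈ with d , a , refl , 1≤d , weight≡N ← ∈diagonal⁻ π∈ =
      subst (_∈ constants) (sym (hookToRow-hook d a a)) (∈constants⁺ {a = a} 1≤d weight≡N)
    from : ∀ {r} → r ∈ constants → rowToHook r ∈ diagonal
    from r∈ with d , a , refl , 1≤d , weight≡N ← ∈constants⁻ r∈ =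
      subst (_∈ diagonal) (sym (rowToHook-constant d a)) (∈diagonal⁺ 1≤d weight≡N)
    from∘to : ∀ {π} → π ∈ diagonal → rowToHook (hookToRow π) ≡ π
    from∘to π∈ with d , a , refl , _ ← ∈diagonal⁻ π∈ =
      trans (cong rowToHook (hookToRow-hook d a a)) (rowToHook-constant d a)
    to∘from : ∀ {r} → r ∈ constants → hookToRow (rowToHook r) ≡ r
    to∘from r∈ with d , a , refl , _ ← ∈constants⁻ r∈ =
      trans (cong hookToRow (rowToHook-constant d a)) (hookToRow-hook d a a)

  length≡length-mod4 : length xs % 4 ≡ length ys % 4
  length≡length-mod4 = begin
    length xs % 4
      ≡⟨ length%4≡2*oneFreeUnmarked%4 _≟ᵖ_ planeMarks enumᵖ isPlaneOverpartition-toggle (1≤#freeᵖ 1≤N) ⟩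
    (2 * length hooks) % 4
      ≡⟨ cong (λ m → (2 * m) % 4) hooks≡diagonal+2*swapped ⟩
    (2 * (length diagonal + 2 * swapped)) % 4
      ≡⟨ 2*[m+2*n]%4 (length diagonal) swapped ⟩
    (2 * length diagonal) % 4
      ≡⟨ cong (λ m → (2 * m) % 4) diagonal≡constants ⟩
    (2 * length constants) % 4
      ≡⟨ length%4≡2*oneFreeUnmarked%4 _≟ʳ_ partMarks enumᵒ isOverpartition-toggle (1≤#freeᵒ 1≤N) ⟨
    length ys % 4 ∎
    where
    open ≡-Reasoning

corollary3p3 : (n : ℕ) →
    Σ (List Plane) λ xs → Σ (List Row) λ ys →
      Enumerates (IsPlaneOverpartition (2 * n + 1)) xs
      × Enumerates (IsOverpartition (2 * n + 1)) ys
      × length xs % 4 ≡ length ys % 4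
corollary3p3 n
  with planes , enumᵖ ← planeOverpartitions (2 * n + 1)
  with parts , enumᵒ ← overpartitions (2 * n + 1) =
  planes , parts , enumᵖ , enumᵒ , OddWeight.length≡length-mod4 n enumᵖ enumᵒ
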